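{- Let $G$ be a connected graph whose longest path has length $p$ and with $c(G) \geq t$. Then there exists a $(P_{2p+1},\text{claw},\text{butterfly},C_4,C_5)$-free graph $H$ with $c(H) \geq t$.
   Context: The length of a path is its number of vertices (so a graph whose longest path has length $p$ contains $P_p$ but not $P_{p+1}$ as a subgraph). Cops and Robbers is played on a connected graph: first the cops are placed on vertices, then the robber chooses a vertex; players alternate turns (cops first), each cop/robber moving to an adjacent vertex or staying put; the cops win if a cop eventually moves onto the robber's vertex. The cop number $c(G)$ is the least number of cops guaranteeing a cop win. A graph is $(H_1,\dots,H_m)$-free if it has no induced subgraph isomorphic to any $H_i$. $P_t$ and $C_t$ denote the path and cycle on $t$ vertices; the claw is $K_{1,3}$; the butterfly is the 5-vertex graph obtained by identifying two triangles at one vertex. -}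

module Defs where

open import Data.Nat using (ℕ; zero; suc; _<_; _∸_; _≡ᵇ_)
open import Data.Fin using (Fin; toℕ)
open import Data.Bool using (Bool; true; false; _∧_; _∨_)
open import Data.List using (List; []; _∷_; map; upTo; _++_)
open import Data.Bool.ListAction using (any)
open import Data.Product using (Σ; ∃; _×_; _,_)
open import Data.Sum using (_⊎_)
open import Relation.Binary.PropositionalEquality using (_≡_)
open import Relation.Nullary using (¬_)
open import Function.Definitions using (Injective)

record Graph : Set where
  field
    n : ℕ
    E : Fin n → Fin n → Bool
open Graph public

V : Graph → Set
V G = Fin (n G)

Adj : (G : Graph) → V G → V G → Set
Adj G u v = E G u v ≡ true

IsSimple : Graph → Set
IsSimple G = (∀ u v → E G u v ≡ E G v u) × (∀ u → E G u u ≡ false)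

data Reach (G : Graph) (u : V G) : V G → Set where
  here : Reach G u u
  step : ∀ {v w} → Reach G u v → Adj G v w → Reach G u w

Connected : Graph → Set
Connected G = (0 < n G) × (∀ u v → Reach G u v)

HasPath : Graph → ℕ → Set
HasPath G m = Σ (Fin m → V G) λ f →
  Injective _≡_ _≡_ f × (∀ (i j : Fin m) → toℕ j ≡ suc (toℕ i) → Adj G (f i) (f j))

-- the longest path of G has length p (number of vertices)
LongestPathLength : Graph → ℕ → Set
LongestPathLength G p = HasPath G p × ¬ HasPath G (suc p)

InducedSub : (F H : Graph) → Set
InducedSub F H = Σ (V F → V H) λ f →
  Injective _≡_ _≡_ f × (∀ i j → E H (f i) (f j) ≡ E F i j)

Free : Graph → Graph → Set
Free F H = ¬ InducedSub F H

fromEdges : ℕ → List (ℕ × ℕ) → Graph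
fromEdges k es = record
  { n = k
  ; E = λ i j → any (λ { (a , b) → ((a ≡ᵇ toℕ i) ∧ (b ≡ᵇ toℕ j)) ∨ ((a ≡ᵇ toℕ j) ∧ (b ≡ᵇ toℕ i)) }) es }

pathEdges : ℕ → List (ℕ × ℕ)
pathEdges t = map (λ i → (i , suc i)) (upTo (t ∸ 1))

Pgraph : ℕ → Graph
Pgraph t = fromEdges t (pathEdges t)

Cgraph : ℕ → Graph
Cgraph t = fromEdges t ((t ∸ 1 , 0) ∷ pathEdges t)

claw : Graph
claw = fromEdges 4 ((0 , 1) ∷ (0 , 2) ∷ (0 , 3) ∷ [])

-- two triangles {0,1,2}, {0,3,4} sharing vertex 0
butterfly : Graph
butterfly = fromEdges 5 ((0 , 1) ∷ (0 , 2) ∷ (1 , 2) ∷ (0 , 3) ∷ (0 , 4) ∷ (3 , 4) ∷ [])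

N[_]_∋_ : (G : Graph) → V G → V G → Set
N[ G ] u ∋ v = (u ≡ v) ⊎ Adj G u v

CopMove : (G : Graph) {k : ℕ} → (Fin k → V G) → (Fin k → V G) → Set
CopMove G c c' = ∀ i → N[ G ] c i ∋ c' i

Caught : (G : Graph) {k : ℕ} → (Fin k → V G) → V G → Set
Caught G c r = ∃ λ i → c i ≡ r

-- CopsWinFrom G c r : cops at c, robber at r, cops to move; the cops can force
-- capture in finitely many rounds (least fixed point / attractor).
data CopsWinFrom (G : Graph) {k : ℕ} : (Fin k → V G) → V G → Set where
  win : ∀ {c r} (c' : Fin k → V G) → CopMove G c c' →
        Caught G c' r ⊎ (∀ r' → N[ G ] r ∋ r' → Caught G c' r' ⊎ CopsWinFrom G c' r') →
        CopsWinFrom G c r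

KCopWin : Graph → ℕ → Set
KCopWin G k = Σ (Fin k → V G) λ c₀ → ∀ r → CopsWinFrom G c₀ r

CopNumberAtLeast : Graph → ℕ → Set
CopNumberAtLeast G t = ∀ k → k < t → ¬ KCopWin G k

{-# OPTIONS --safe #-}
-- Replace each vertex v of G by a clique, its bag {⟨ v , w ⟩ : w ∈ V G}, and match ⟨ v , w ⟩ with
-- ⟨ w , v ⟩ for every edge vw of G. Every vertex then has at most one neighbour outside its bag, so
-- triangles lie inside bags and along an induced path bag edges and matching edges alternate. This
-- excludes claws, butterflies, C₄ and C₅, and the bags of every other vertex of an induced path on
-- 2p+1 vertices form a path on p+1 vertices of G. A robber move v → u in G is played in H as the two
-- moves into ⟨ v , u ⟩ and across to ⟨ u , v ⟩; as two cop moves of H project to at most one cop move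
-- of G, cops of G shadowing the bags of winning cops of H win as well.
module Submission where

open import Defs
open import Data.Nat using (ℕ; suc; _*_)
open import Data.Product using (Σ; _×_)

open import Data.Bool using (true; T; _∧_; _∨_)
open import Data.Bool.Properties using (T-≡; T-∧; T-∨) renaming (_≟_ to _≟ᵇ_)
open import Data.Empty using (⊥)
open import Data.Fin using (Fin; toℕ; fromℕ<; combine; remQuot; #_)
open import Data.Fin.Properties
  using (_≟_; toℕ-injective; toℕ-fromℕ<; toℕ<n; remQuot-combine; combine-remQuot)
open import Data.List.Membership.Propositional using (_∈_; lose; find)
open import Data.List.Membership.Propositional.Properties using (∈-map⁺; ∈-map⁻; ∈-upTo⁺)
open import Data.List.Relation.Unary.Any.Properties using (any⁺; any⁻)
open import Data.Nat using (_<_; _≡ᵇ_; s≤s; s≤s⁻¹)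
open import Data.Nat.Properties
  using (≡ᵇ⇒≡; ≡⇒≡ᵇ; even≢odd; 1+n≢n; *-suc; *-cancelˡ-≡; *-mono-≤; *-monoʳ-≤; <-trans; n<1+n)
open import Data.Product using (_,_; proj₁; proj₂; ∃₂)
open import Data.Sum using (_⊎_; inj₁; inj₂; [_,_])
import Data.Sum as Sum
open import Data.Vec.Functional using (updateAt)
open import Data.Vec.Functional.Properties using (updateAt-updates; updateAt-minimal)
open import Function using (_∘_; const; case_of_)
open import Function.Bundles using (Equivalence; mk⇔)
open import Function.Definitions using (Injective)
open import Relation.Binary.PropositionalEquality
  using (_≡_; _≢_; refl; sym; trans; cong; cong₂; subst; subst₂)
open import Relation.Nullary using (¬_; Dec; yes; no; does; contradiction; ¬?; _×-dec_; _⊎-dec_)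
open import Relation.Nullary.Decidable using (dec-true; dec-false; does-⇔; decidable-stable)

dec-true⁻¹ : ∀ {a} {A : Set a} (a? : Dec A) → does a? ≡ true → A
dec-true⁻¹ (yes a) _ = a

fromEdges-adj⁺ : ∀ {k es} {i j : Fin k} → (toℕ i , toℕ j) ∈ es → Adj (fromEdges k es) i j
fromEdges-adj⁺ {i = i} {j} ij∈es = Equivalence.to T-≡ (any⁺ _ (lose ij∈es matches))
  where
  matches : T (((toℕ i ≡ᵇ toℕ i) ∧ (toℕ j ≡ᵇ toℕ j)) ∨ ((toℕ i ≡ᵇ toℕ j) ∧ (toℕ j ≡ᵇ toℕ i)))
  matches = Equivalence.from (T-∨ {(toℕ i ≡ᵇ toℕ i) ∧ (toℕ j ≡ᵇ toℕ j)})
    (inj₁ (Equivalence.from (T-∧ {toℕ i ≡ᵇ toℕ i}) (≡⇒≡ᵇ (toℕ i) _ refl , ≡⇒≡ᵇ (toℕ j) _ refl)))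

fromEdges-adj⁻ : ∀ {k es} {i j : Fin k} → Adj (fromEdges k es) i j →
                 ∃₂ λ a b → (a , b) ∈ es × (a ≡ toℕ i × b ≡ toℕ j ⊎ a ≡ toℕ j × b ≡ toℕ i)
fromEdges-adj⁻ {es = es} ij with find (any⁻ _ es (Equivalence.from T-≡ ij))
... | (a , b) , ab∈es , ab~ij = a , b , ab∈es , Sum.map ends ends (Equivalence.to T-∨ ab~ij)
  where
  ends : ∀ {x y} → T ((a ≡ᵇ x) ∧ (b ≡ᵇ y)) → a ≡ x × b ≡ y
  ends ab~xy with a~x , b~y ← Equivalence.to T-∧ ab~xy = ≡ᵇ⇒≡ _ _ a~x , ≡ᵇ⇒≡ _ _ b~y

Pgraph-adj⁺ : ∀ {t} {i j : Fin t} → toℕ j ≡ suc (toℕ i) → Adj (Pgraph t) i j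
Pgraph-adj⁺ {suc t} {i} {j} j≡1+i =
  fromEdges-adj⁺ (subst (λ b → (toℕ i , b) ∈ pathEdges (suc t)) (sym j≡1+i) (∈-map⁺ _ (∈-upTo⁺ i<t)))
  where
  i<t : toℕ i < t
  i<t = s≤s⁻¹ (subst (_< suc t) j≡1+i (toℕ<n j))

Pgraph-adj⁻ : ∀ {t} {i j : Fin t} → Adj (Pgraph t) i j → toℕ j ≡ suc (toℕ i) ⊎ toℕ i ≡ suc (toℕ j)
Pgraph-adj⁻ {t} ij
  with _ , _ , ab∈es , ends ← fromEdges-adj⁻ {es = pathEdges t} ij
  with _ , _ , refl ← ∈-map⁻ (λ m → m , suc m) ab∈es = Sum.map consecutive consecutive ends
  where
  consecutive : ∀ {m x y} → m ≡ x × suc m ≡ y → y ≡ suc x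
  consecutive (m≡x , 1+m≡y) = trans (sym 1+m≡y) (cong suc m≡x)

Pgraph-even-nonadj : ∀ {t} {i j : Fin t} a b → toℕ i ≡ 2 * a → toℕ j ≡ 2 * b → ¬ Adj (Pgraph t) i j
Pgraph-even-nonadj a b i≡2a j≡2b ij = [ no-step a b i≡2a j≡2b , no-step b a j≡2b i≡2a ] (Pgraph-adj⁻ ij)
  where
  no-step : ∀ c d {x y} → x ≡ 2 * c → y ≡ 2 * d → y ≢ suc x
  no-step c d x≡2c y≡2d y≡1+x = even≢odd d c (trans (sym y≡2d) (trans y≡1+x (cong suc x≡2c)))

reach-∋ : ∀ {K u v w} → Reach K u v → N[ K ] v ∋ w → Reach K u w
reach-∋ r (inj₁ refl) = r
reach-∋ r (inj₂ vw) = step r vw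

capture-next : ∀ {K k} (c : Fin k → V K) (i : Fin k) {u} → N[ K ] c i ∋ u → CopsWinFrom K c u
capture-next {K} c i {u} c∋u = win c′ move (inj₁ (i , updateAt-updates i c))
  where
  c′ : Fin _ → V K
  c′ = updateAt c i (const u)
  move : CopMove K c c′
  move j with j ≟ i
  ... | yes refl = subst (N[ K ] c j ∋_) (sym (updateAt-updates j c)) c∋u
  ... | no j≢i = inj₁ (sym (updateAt-minimal j i c j≢i))

Outcome RobberMoves : (K : Graph) {k : ℕ} → (Fin k → V K) → V K → Set
Outcome K c r = Caught K c r ⊎ CopsWinFrom K c r
RobberMoves K c r = ∀ r′ → N[ K ] r ∋ r′ → Outcome K c r′

module Blowup (G : Graph) (G-simple : IsSimple G) where

  Vertex : Set
  Vertex = Fin (n G * n G)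

  bag port : Vertex → V G
  bag x = proj₁ (remQuot {n G} (n G) x)
  port x = proj₂ (remQuot {n G} (n G) x)

  ⟨_,_⟩ : V G → V G → Vertex
  ⟨ v , w ⟩ = combine {n G} {n G} v w

  bag-⟨⟩ : ∀ v w → bag ⟨ v , w ⟩ ≡ v
  bag-⟨⟩ v w = cong proj₁ (remQuot-combine {n G} {n G} v w)

  port-⟨⟩ : ∀ v w → port ⟨ v , w ⟩ ≡ w
  port-⟨⟩ v w = cong proj₂ (remQuot-combine {n G} {n G} v w)

  ⟨bag,port⟩ : ∀ x → ⟨ bag x , port x ⟩ ≡ x
  ⟨bag,port⟩ = combine-remQuot {n G} (n G)

  vertex-≡ : ∀ {x y} → bag x ≡ bag y → port x ≡ port y → x ≡ y
  vertex-≡ {x} {y} b p = trans (sym (⟨bag,port⟩ x)) (trans (cong₂ ⟨_,_⟩ b p) (⟨bag,port⟩ y))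

  -- ⟨ v , w ⟩ is the port of v towards w. Every vertex w gets a port in the bag of v, so that
  -- H has vertex set Fin (n G * n G); ports towards non-neighbours of v simply stay unmatched.
  BagEdge MatchEdge Link : Vertex → Vertex → Set
  BagEdge x y = bag x ≡ bag y × port x ≢ port y
  MatchEdge x y = bag x ≡ port y × port x ≡ bag y × Adj G (bag x) (port x)
  Link x y = BagEdge x y ⊎ MatchEdge x y

  link? : ∀ x y → Dec (Link x y)
  link? x y = (bag x ≟ bag y ×-dec ¬? (port x ≟ port y))
        ⊎-dec (bag x ≟ port y ×-dec port x ≟ bag y ×-dec E G (bag x) (port x) ≟ᵇ true)

  H : Graph
  H = record { n = n G * n G ; E = λ x y → does (link? x y) }

  adj⇒link : ∀ {x y} → Adj H x y → Link x y
  adj⇒link {x} {y} = dec-true⁻¹ (link? x y)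

  link⇒adj : ∀ {x y} → Link x y → Adj H x y
  link⇒adj {x} {y} = dec-true (link? x y)

  bag-clique : ∀ {x y} → bag x ≡ bag y → x ≢ y → Adj H x y
  bag-clique b x≢y = link⇒adj (inj₁ (b , x≢y ∘ vertex-≡ b))

  separated : ∀ {x y} → x ≢ y → ¬ Adj H x y → bag x ≢ bag y
  separated x≢y ¬xy b = ¬xy (bag-clique b x≢y)

  within-bag : ∀ {x y} → bag x ≡ bag y → N[ H ] x ∋ y
  within-bag {x} {y} b with x ≟ y
  ... | yes x≡y = inj₁ x≡y
  ... | no x≢y = inj₂ (bag-clique b x≢y)

  match-⟨⟩ : ∀ {v w} → Adj G v w → Adj H ⟨ v , w ⟩ ⟨ w , v ⟩
  match-⟨⟩ {v} {w} vw = link⇒adj (inj₂ ( trans (bag-⟨⟩ v w) (sym (port-⟨⟩ w v))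
                                       , trans (port-⟨⟩ v w) (sym (bag-⟨⟩ w v))
                                       , subst₂ (Adj G) (sym (bag-⟨⟩ v w)) (sym (port-⟨⟩ v w)) vw))

  match-sym : ∀ {x y} → MatchEdge x y → MatchEdge y x
  match-sym (b , p , xy) = sym p , sym b , subst₂ (Adj G) p b (trans (proj₁ G-simple _ _) xy)

  match-unique : ∀ {x y z} → MatchEdge x y → MatchEdge x z → y ≡ z
  match-unique (b , p , _) (b′ , p′ , _) = vertex-≡ (trans (sym p) p′) (trans (sym b) b′)

  match-involutive : ∀ {x y z} → MatchEdge x y → MatchEdge y z → x ≡ z
  match-involutive xy = match-unique (match-sym xy)

  match-crosses : ∀ {x y} → MatchEdge x y → bag x ≢ bag y
  match-crosses {x} (_ , p , xy) b = case trans (sym loop) (proj₂ G-simple (bag x)) of λ ()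
    where
    loop : Adj G (bag x) (bag x)
    loop = subst (Adj G (bag x)) (trans p (sym b)) xy

  link-sym : ∀ {x y} → Link x y → Link y x
  link-sym = Sum.map (λ (b , p) → sym b , p ∘ sym) match-sym

  link-irrefl : ∀ {x} → ¬ Link x x
  link-irrefl = [ (λ (_ , p) → p refl) , (λ m → match-crosses m refl) ]

  H-simple : IsSimple H
  H-simple = (λ x y → does-⇔ (mk⇔ link-sym link-sym) (link? x y) (link? y x))
           , (λ x → dec-false (link? x x) link-irrefl)

  reach-lift : ∀ {v v′} → Reach G v v′ → ∀ w w′ → Reach H ⟨ v , w ⟩ ⟨ v′ , w′ ⟩
  reach-lift {v} here w w′ = reach-∋ here (within-bag (trans (bag-⟨⟩ v w) (sym (bag-⟨⟩ v w′))))
  reach-lift (step {u} {v′} r uv′) w w′ =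
    reach-∋ (step (reach-lift r w v′) (match-⟨⟩ uv′)) (within-bag (trans (bag-⟨⟩ v′ u) (sym (bag-⟨⟩ v′ w′))))

  H-connected : Connected G → Connected H
  H-connected (0<n , reach) = *-mono-≤ 0<n 0<n , λ x y →
    subst₂ (Reach H) (⟨bag,port⟩ x) (⟨bag,port⟩ y) (reach-lift (reach (bag x) (bag y)) (port x) (port y))

  adj⇒bag-step : ∀ {x y} → Adj H x y → N[ G ] bag x ∋ bag y
  adj⇒bag-step {x} xy with adj⇒link xy
  ... | inj₁ (b , _) = inj₁ b
  ... | inj₂ (_ , p , a) = inj₂ (subst (Adj G (bag x)) p a)

  step-bag : ∀ {x y} → N[ H ] x ∋ y → N[ G ] bag x ∋ bag y
  step-bag (inj₁ refl) = inj₁ refl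
  step-bag (inj₂ xy) = adj⇒bag-step xy

  adj-adj⇒bag-step : ∀ {x y z} → Adj H x y → Adj H y z → x ≡ z ⊎ N[ G ] bag x ∋ bag z
  adj-adj⇒bag-step {x} xy yz with adj⇒link xy | adj⇒link yz
  ... | inj₁ (b , _) | inj₁ (b′ , _) = inj₂ (inj₁ (trans b b′))
  ... | inj₁ (b , _) | inj₂ (_ , p′ , a′) = inj₂ (inj₂ (subst₂ (Adj G) (sym b) p′ a′))
  ... | inj₂ (_ , p , a) | inj₁ (b′ , _) = inj₂ (inj₂ (subst (Adj G (bag x)) (trans p b′) a))
  ... | inj₂ m | inj₂ m′ = inj₁ (match-involutive m m′)

  steps-bag : ∀ {x y z} → N[ H ] x ∋ y → N[ H ] y ∋ z → N[ G ] bag x ∋ bag z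
  steps-bag (inj₁ refl) yz = step-bag yz
  steps-bag (inj₂ xy) (inj₁ refl) = adj⇒bag-step xy
  steps-bag (inj₂ xy) (inj₂ yz) with adj-adj⇒bag-step xy yz
  ... | inj₁ refl = inj₁ refl
  ... | inj₂ s = s

  induced-P₃-bags : ∀ {x y z} → Adj H x y → Adj H y z → x ≢ z → ¬ Adj H x z → Adj G (bag x) (bag z)
  induced-P₃-bags xy yz x≢z ¬xz with adj-adj⇒bag-step xy yz
  ... | inj₁ x≡z = contradiction x≡z x≢z
  ... | inj₂ (inj₁ b) = contradiction b (separated x≢z ¬xz)
  ... | inj₂ (inj₂ a) = a

  triangle⇒bag : ∀ {x y z} → Adj H x y → Adj H x z → Adj H y z → y ≢ z → bag x ≡ bag y
  triangle⇒bag xy xz yz y≢z with adj⇒link xy | adj⇒link xz | adj⇒link yz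
  ... | inj₁ (b , _) | _ | _ = b
  ... | inj₂ m | inj₂ m′ | _ = contradiction (match-unique m m′) y≢z
  ... | inj₂ _ | inj₁ (b , _) | inj₁ (b′ , _) = trans b (sym b′)
  ... | inj₂ m | inj₁ (_ , p) | inj₂ m′ = contradiction (cong port (match-involutive m m′)) p

  ¬match-bag-square : ∀ {a b c d} → MatchEdge a b → BagEdge b c → MatchEdge c d → ¬ BagEdge d a
  ¬match-bag-square (_ , p , _) (b , _) (b′ , _ , _) (_ , p′) = p′ (sym (trans p (trans b b′)))

  module Induced {F : Graph} (f : V F → Vertex) (f-injective : Injective _≡_ _≡_ f)
                 (f-E : ∀ i j → E H (f i) (f j) ≡ E F i j) where

    adj : ∀ i j → Adj F i j → Adj H (f i) (f j)
    adj i j ij = trans (f-E i j) ij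

    nonadj : ∀ i j → ¬ Adj F i j → ¬ Adj H (f i) (f j)
    nonadj i j ¬ij fij = ¬ij (trans (sym (f-E i j)) fij)

    Linked : V F → V F → Set
    Linked i j = Link (f i) (f j)

    link : ∀ i j → Adj F i j → Linked i j
    link i j = adj⇒link ∘ adj i j

    distinct : ∀ i j → i ≢ j → f i ≢ f j
    distinct i j i≢j = i≢j ∘ f-injective

    apart : ∀ i j → i ≢ j → ¬ Adj F i j → bag (f i) ≢ bag (f j)
    apart i j i≢j ¬ij = separated (distinct i j i≢j) (nonadj i j ¬ij)

    ¬bag-bag : ∀ i j k → i ≢ k → ¬ Adj F i k → BagEdge (f i) (f j) → ¬ BagEdge (f j) (f k)
    ¬bag-bag i j k i≢k ¬ik (b , _) (b′ , _) = apart i k i≢k ¬ik (trans b b′)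

    ¬match-match : ∀ i j k → i ≢ k → MatchEdge (f i) (f j) → ¬ MatchEdge (f j) (f k)
    ¬match-match i j k i≢k m m′ = distinct i k i≢k (match-involutive m m′)

  claw-free : Free claw H
  claw-free (f , f-injective , f-E) =
    two-alike (link (# 0) (# 1) refl) (link (# 0) (# 2) refl) (link (# 0) (# 3) refl)
    where
    open Induced f f-injective f-E
    two-alike : Linked (# 0) (# 1) → Linked (# 0) (# 2) → Linked (# 0) (# 3) → ⊥
    two-alike (inj₁ (b₁ , _)) (inj₁ (b₂ , _)) _ = apart (# 1) (# 2) (λ ()) (λ ()) (trans (sym b₁) b₂)
    two-alike (inj₁ (b₁ , _)) _ (inj₁ (b₃ , _)) = apart (# 1) (# 3) (λ ()) (λ ()) (trans (sym b₁) b₃)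
    two-alike _ (inj₁ (b₂ , _)) (inj₁ (b₃ , _)) = apart (# 2) (# 3) (λ ()) (λ ()) (trans (sym b₂) b₃)
    two-alike (inj₂ m₁) (inj₂ m₂) _ = distinct (# 1) (# 2) (λ ()) (match-unique m₁ m₂)
    two-alike (inj₂ m₁) _ (inj₂ m₃) = distinct (# 1) (# 3) (λ ()) (match-unique m₁ m₃)
    two-alike _ (inj₂ m₂) (inj₂ m₃) = distinct (# 2) (# 3) (λ ()) (match-unique m₂ m₃)

  butterfly-free : Free butterfly H
  butterfly-free (f , f-injective , f-E) = apart (# 1) (# 3) (λ ()) (λ ()) (trans (sym bag₀≡bag₁) bag₀≡bag₃)
    where
    open Induced f f-injective f-E
    bag₀≡bag₁ : bag (f (# 0)) ≡ bag (f (# 1))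
    bag₀≡bag₁ = triangle⇒bag (adj (# 0) (# 1) refl) (adj (# 0) (# 2) refl) (adj (# 1) (# 2) refl)
                             (distinct (# 1) (# 2) (λ ()))
    bag₀≡bag₃ : bag (f (# 0)) ≡ bag (f (# 3))
    bag₀≡bag₃ = triangle⇒bag (adj (# 0) (# 3) refl) (adj (# 0) (# 4) refl) (adj (# 3) (# 4) refl)
                             (distinct (# 3) (# 4) (λ ()))

  C₄-free : Free (Cgraph 4) H
  C₄-free (f , f-injective , f-E) =
    alternating (link (# 0) (# 1) refl) (link (# 1) (# 2) refl) (link (# 2) (# 3) refl) (link (# 3) (# 0) refl)
    where
    open Induced f f-injective f-E
    alternating : Linked (# 0) (# 1) → Linked (# 1) (# 2) → Linked (# 2) (# 3) → Linked (# 3) (# 0) → ⊥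
    alternating (inj₁ s₀) (inj₁ s₁) _ _ = ¬bag-bag (# 0) (# 1) (# 2) (λ ()) (λ ()) s₀ s₁
    alternating _ (inj₁ s₁) (inj₁ s₂) _ = ¬bag-bag (# 1) (# 2) (# 3) (λ ()) (λ ()) s₁ s₂
    alternating _ _ (inj₁ s₂) (inj₁ s₃) = ¬bag-bag (# 2) (# 3) (# 0) (λ ()) (λ ()) s₂ s₃
    alternating (inj₂ m₀) (inj₂ m₁) _ _ = ¬match-match (# 0) (# 1) (# 2) (λ ()) m₀ m₁
    alternating _ (inj₂ m₁) (inj₂ m₂) _ = ¬match-match (# 1) (# 2) (# 3) (λ ()) m₁ m₂
    alternating _ _ (inj₂ m₂) (inj₂ m₃) = ¬match-match (# 2) (# 3) (# 0) (λ ()) m₂ m₃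
    alternating (inj₁ s₀) (inj₂ m₁) (inj₁ s₂) (inj₂ m₃) = ¬match-bag-square m₁ s₂ m₃ s₀
    alternating (inj₂ m₀) (inj₁ s₁) (inj₂ m₂) (inj₁ s₃) = ¬match-bag-square m₀ s₁ m₂ s₃

  C₅-free : Free (Cgraph 5) H
  C₅-free (f , f-injective , f-E) =
    alternating (link (# 0) (# 1) refl) (link (# 1) (# 2) refl) (link (# 2) (# 3) refl)
                (link (# 3) (# 4) refl) (link (# 4) (# 0) refl)
    where
    open Induced f f-injective f-E
    alternating : Linked (# 0) (# 1) → Linked (# 1) (# 2) → Linked (# 2) (# 3) → Linked (# 3) (# 4) →
                  Linked (# 4) (# 0) → ⊥
    alternating (inj₁ s₀) (inj₁ s₁) _ _ _ = ¬bag-bag (# 0) (# 1) (# 2) (λ ()) (λ ()) s₀ s₁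
    alternating _ (inj₁ s₁) (inj₁ s₂) _ _ = ¬bag-bag (# 1) (# 2) (# 3) (λ ()) (λ ()) s₁ s₂
    alternating _ _ (inj₁ s₂) (inj₁ s₃) _ = ¬bag-bag (# 2) (# 3) (# 4) (λ ()) (λ ()) s₂ s₃
    alternating _ _ _ (inj₁ s₃) (inj₁ s₄) = ¬bag-bag (# 3) (# 4) (# 0) (λ ()) (λ ()) s₃ s₄
    alternating (inj₁ s₀) _ _ _ (inj₁ s₄) = ¬bag-bag (# 4) (# 0) (# 1) (λ ()) (λ ()) s₄ s₀
    alternating (inj₂ m₀) (inj₂ m₁) _ _ _ = ¬match-match (# 0) (# 1) (# 2) (λ ()) m₀ m₁
    alternating _ (inj₂ m₁) (inj₂ m₂) _ _ = ¬match-match (# 1) (# 2) (# 3) (λ ()) m₁ m₂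
    alternating _ _ (inj₂ m₂) (inj₂ m₃) _ = ¬match-match (# 2) (# 3) (# 4) (λ ()) m₂ m₃
    alternating _ _ _ (inj₂ m₃) (inj₂ m₄) = ¬match-match (# 3) (# 4) (# 0) (λ ()) m₃ m₄
    alternating (inj₂ m₀) _ _ _ (inj₂ m₄) = ¬match-match (# 4) (# 0) (# 1) (λ ()) m₄ m₀

  induced-path⇒path : ∀ m → InducedSub (Pgraph (suc (2 * m))) H → HasPath G (suc m)
  induced-path⇒path m (f , f-injective , f-E) = g , g-injective , g-adjacent
    where
    open Induced f f-injective f-E

    even : Fin (suc m) → Fin (suc (2 * m))
    even j = fromℕ< (s≤s (*-monoʳ-≤ 2 (s≤s⁻¹ (toℕ<n j))))

    toℕ-even : ∀ j → toℕ (even j) ≡ 2 * toℕ j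
    toℕ-even j = toℕ-fromℕ< _

    even-injective : Injective _≡_ _≡_ even
    even-injective {i} {j} e =
      toℕ-injective (*-cancelˡ-≡ _ _ 2 (trans (sym (toℕ-even i)) (trans (cong toℕ e) (toℕ-even j))))

    evens-nonadj : ∀ i j → ¬ Adj (Pgraph _) (even i) (even j)
    evens-nonadj i j = Pgraph-even-nonadj (toℕ i) (toℕ j) (toℕ-even i) (toℕ-even j)

    g : Fin (suc m) → V G
    g j = bag (f (even j))

    g-injective : Injective _≡_ _≡_ g
    g-injective {i} {j} gi≡gj = decidable-stable (i ≟ j) λ i≢j →
      apart (even i) (even j) (i≢j ∘ even-injective) (evens-nonadj i j) gi≡gj

    g-adjacent : ∀ i j → toℕ j ≡ suc (toℕ i) → Adj G (g i) (g j)
    g-adjacent i j j≡1+i = induced-P₃-bags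
      (adj (even i) odd (Pgraph-adj⁺ (trans toℕ-odd (cong suc (sym (toℕ-even i))))))
      (adj odd (even j) (Pgraph-adj⁺ (trans toℕ-even-j (cong suc (sym toℕ-odd)))))
      (distinct (even i) (even j) (λ ei≡ej → 1+n≢n (sym (trans (cong toℕ (even-injective ei≡ej)) j≡1+i))))
      (nonadj (even i) (even j) (evens-nonadj i j))
      where
      toℕ-even-j : toℕ (even j) ≡ suc (suc (2 * toℕ i))
      toℕ-even-j = trans (toℕ-even j) (trans (cong (2 *_) j≡1+i) (*-suc 2 (toℕ i)))

      odd<1+2m : suc (2 * toℕ i) < suc (2 * m)
      odd<1+2m = <-trans (n<1+n _) (subst (_< suc (2 * m)) toℕ-even-j (toℕ<n (even j)))

      odd : Fin (suc (2 * m))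
      odd = fromℕ< odd<1+2m

      toℕ-odd : toℕ odd ≡ suc (2 * toℕ i)
      toℕ-odd = toℕ-fromℕ< odd<1+2m

  next-to-port : ∀ {x v u} → N[ H ] x ∋ ⟨ v , u ⟩ → Adj G v u → N[ G ] bag x ∋ u
  next-to-port {v = v} {u} (inj₁ refl) vu = inj₂ (subst (λ w → Adj G w u) (sym (bag-⟨⟩ v u)) vu)
  next-to-port {v = v} {u} (inj₂ x∼vu) vu with adj⇒link x∼vu
  ... | inj₁ (b , _) = inj₂ (subst (λ w → Adj G w u) (sym (trans b (bag-⟨⟩ v u))) vu)
  ... | inj₂ (b , _ , _) = inj₁ (trans b (port-⟨⟩ v u))

  caught-bag : ∀ {k} {c : Fin k → Vertex} {r v} → bag r ≡ v → Caught H c r → Caught G (bag ∘ c) v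
  caught-bag r↦v (i , ci≡r) = i , trans (cong bag ci≡r) r↦v

  -- The cops of G stand on the bags of the H-cops' positions one round of H earlier (cp, with
  -- CopMove H cp c), because H plays two rounds for each round of G.
  mutual
    shadow : ∀ {k} {cp c : Fin k → Vertex} {r v} → CopMove H cp c → CopsWinFrom H c r → bag r ≡ v →
             CopsWinFrom G (bag ∘ cp) v
    shadow lag (win c′ move outcome) r↦v =
      win (bag ∘ c′) (λ i → steps-bag (lag i) (move i)) (respond r↦v outcome)

    respond : ∀ {k} {c : Fin k → Vertex} {r v} → bag r ≡ v → Caught H c r ⊎ RobberMoves H c r →
              Caught G (bag ∘ c) v ⊎ RobberMoves G (bag ∘ c) v
    respond r↦v (inj₁ caught) = inj₁ (caught-bag r↦v caught)
    respond {r = r} {v} r↦v (inj₂ moves) = inj₂ λ where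
      u (inj₁ v≡u) → stay (trans r↦v v≡u) (moves r (inj₁ refl))
      u (inj₂ vu) → inj₂ (cross vu (moves ⟨ v , u ⟩ (within-bag (trans r↦v (sym (bag-⟨⟩ v u))))))

    stay : ∀ {k} {c : Fin k → Vertex} {r u} → bag r ≡ u → Outcome H c r → Outcome G (bag ∘ c) u
    stay r↦u (inj₁ caught) = inj₁ (caught-bag r↦u caught)
    stay r↦u (inj₂ wins) = inj₂ (shadow (λ _ → inj₁ refl) wins r↦u)

    cross : ∀ {k} {c : Fin k → Vertex} {v u} → Adj G v u → Outcome H c ⟨ v , u ⟩ → CopsWinFrom G (bag ∘ c) u
    cross {c = c} vu (inj₁ (i , ci≡vu)) = capture-next (bag ∘ c) i (next-to-port (inj₁ ci≡vu) vu)
    cross {c = c} vu (inj₂ (win c′ move (inj₁ (i , c′i≡vu)))) =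
      capture-next (bag ∘ c) i (next-to-port (subst (N[ H ] c i ∋_) c′i≡vu (move i)) vu)
    cross {v = v} {u} vu (inj₂ (win c′ move (inj₂ moves))) =
      cross-back move (moves ⟨ u , v ⟩ (inj₂ (match-⟨⟩ vu)))

    cross-back : ∀ {k} {c c′ : Fin k → Vertex} {v u} → CopMove H c c′ → Outcome H c′ ⟨ u , v ⟩ →
                 CopsWinFrom G (bag ∘ c) u
    cross-back {c = c} {v = v} {u} move (inj₁ (i , c′i≡uv)) =
      capture-next (bag ∘ c) i
        (subst (N[ G ] bag (c i) ∋_) (trans (cong bag c′i≡uv) (bag-⟨⟩ u v)) (step-bag (move i)))
    cross-back {v = v} {u} move (inj₂ wins) = shadow move wins (bag-⟨⟩ u v)

  cop-win-projects : ∀ k → KCopWin H k → KCopWin G k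
  cop-win-projects k (c₀ , wins) = bag ∘ c₀ , λ v → shadow (λ _ → inj₁ refl) (wins ⟨ v , v ⟩) (bag-⟨⟩ v v)

  cop-number-lifts : ∀ t → CopNumberAtLeast G t → CopNumberAtLeast H t
  cop-number-lifts t c≥t k k<t = c≥t k k<t ∘ cop-win-projects k

theorem1p3 : (G : Graph) (p t : ℕ) → IsSimple G → Connected G → LongestPathLength G p → CopNumberAtLeast G t →
    Σ Graph λ H → IsSimple H × Connected H × Free (Pgraph (suc (2 * p))) H × Free claw H × Free butterfly H × Free (Cgraph 4) H × Free (Cgraph 5) H × CopNumberAtLeast H t
theorem1p3 G p t G-simple G-connected (_ , no-longer-path) c≥t =
  H , H-simple , H-connected G-connected , no-longer-path ∘ induced-path⇒path p ,
  claw-free , butterfly-free , C₄-free , C₅-free , cop-number-lifts t c≥t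
  where open Blowup G G-simple
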